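{- Let $p\ge3$ be an integer, $u$ an integer coprime to $p$, and $r_1$ the integer with $0<r_1<p$ and $ur_1\equiv1\pmod p$. Put $r_0=p$ and for $1\le i\le t$ define integers $Z_i$, $r_{i+1}$ by $r_{i-1}=Z_ir_i+r_{i+1}$, $0\le r_{i+1}<r_i$, where $t$ is the index with $r_t=1$. Let $a<b$ be integers with $1<b-a<p$ such that $$\max(\langle ua\rangle_p,\langle ub\rangle_p)<\min_{a<n<b}\langle un\rangle_p,$$ and suppose $\langle ua\rangle_p>\langle ub\rangle_p$. Then $b-a=r_{2k}-zr_{2k+1}$ for some integer $k\ge0$ with $2k+1\le t$ and some $0\le z\le Z_{2k+1}-1$.
   Context: $\langle x\rangle_p$ denotes the least nonnegative residue of the integer $x$ modulo $p$. -}

module Defs where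

open import Data.Nat using (ℕ; zero; suc)
open import Data.Nat.DivMod using (_%_; _/_)
open import Data.Integer using (ℤ)
open import Data.Integer.DivMod using (_%ℕ_)
open import Data.Product using (_×_; _,_; proj₁)

-- ⟨ x ⟩ p : least nonnegative residue of x modulo p (p ≠ 0; 0 for p = 0, never used)
⟨_⟩_ : ℤ → ℕ → ℕ
⟨ x ⟩ zero = 0
⟨ x ⟩ (suc n) = x %ℕ suc n

-- total versions of ℕ mod/div (value at divisor 0 is irrelevant: the
-- Euclidean sequence is only used up to the index t with r_t = 1)
_%'_ : ℕ → ℕ → ℕ
x %' zero = 0
x %' suc n = x % suc n

_/'_ : ℕ → ℕ → ℕ
x /' zero = 0
x /' suc n = x / suc n

-- pairs (r_i , r_{i+1}) of the Euclidean algorithm started at (r₀ , r₁) = (p , r₁)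
rpair : ℕ → ℕ → ℕ → ℕ × ℕ
rpair p r₁ zero = p , r₁
rpair p r₁ (suc i) with rpair p r₁ i
... | x , y = y , x %' y

r : ℕ → ℕ → ℕ → ℕ
r p r₁ i = proj₁ (rpair p r₁ i)

-- Z p r₁ i = Z_i  (r_{i-1} = Z_i r_i + r_{i+1}), meaningful for i ≥ 1
Z : ℕ → ℕ → ℕ → ℕ
Z p r₁ zero = 0
Z p r₁ (suc i) = r p r₁ i /' r p r₁ (suc i)

{-# OPTIONS --safe #-}
-- Put A = ⟨ua⟩ₚ, B = ⟨ub⟩ₚ, d = b − a and c = A − B > 0. As u r₁ ≡ 1 (mod p),
-- r₁ c + d ≡ r₁ u (a − b) + (b − a) ≡ 0 (mod p), and the interval condition makes c minimal:
-- from r₁ c′ + d′ ≡ 0 with 0 < c′ < c and 0 ≤ d′ ≤ d we would get ⟨u(a + d′)⟩ₚ = A − c′,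
-- which is impossible for d′ = 0 (value A), for d′ = d (value B, so c′ = c) and for
-- a < a + d′ < b (value below max(A, B)).
-- Write r₁ c + d = m p, p = Z₁ r₁ + r₂ and r₁ = Z₂ r₂ + r₃. If c < Z₁ then m = 1, i.e.
-- d = r₀ − c r₁; if c = Z₁ then d = r₂. If c > Z₁, minimality tested against r₁ Z₁ + r₂ = p
-- gives d < r₂, and then c = m Z₁ + c₂, m = Z₂ c₂ + m₂ with r₃ c₂ + d = m₂ r₂, where c₂ is
-- again minimal; so the analysis repeats two places further down the remainder sequence.
module Submission where

open import Defs
open import Data.Nat using (ℕ; _≤_; _<_; _⊔_; _*_; _+_)
open import Data.Integer using (ℤ; +_) renaming (_*_ to _*ℤ_; _-_ to _-ℤ_; _<_ to _<ℤ_)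
open import Data.Integer.Divisibility using () renaming (_∣_ to _∣ℤ_)
open import Data.Nat.Coprimality using (Coprime)
open import Data.Integer using (∣_∣)
open import Data.Product using (Σ; _×_)
open import Relation.Binary.PropositionalEquality using (_≡_)

open import Data.Empty using (⊥; ⊥-elim)
open import Data.Integer using (+<+) renaming (_+_ to _+ℤ_)
import Data.Integer.Properties as ℤ
open import Data.Integer.DivMod using (_%ℕ_; _/ℕ_; n%ℕd<d; a≡a%ℕn+[a/ℕn]*n)
open import Data.Integer.Divisibility.Signed as Signed
  using (∣ᵤ⇒∣; ∣⇒∣ᵤ; ∣m∣n⇒∣m+n; ∣m∣n⇒∣m-n; ∣n⇒∣m*n; ∣m⇒∣m*n) renaming (_∣_ to _∣ˢ_)
import Data.Integer.Tactic.RingSolver as ℤ-Ring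
open import Data.Nat using (zero; suc; _∸_; NonZero; >-nonZero; z≤n; s≤s; s≤s⁻¹; z<s)
open import Data.Nat.Properties
open import Data.Nat.DivMod using (m%n≤n; m%n<n; m≡m%n+[m/n]*n; m≥n⇒m/n>0; m/n*n≤m)
open import Data.Nat.Divisibility using (_∣_; _∤_; divides; ∣-refl; _∣0; ∣n∣m%n⇒∣m; >⇒∤; ∣⇒≤; ∣1⇒≡1)
import Data.Nat.Coprimality as Coprime
open import Data.Nat.Induction using (<-wellFounded)
open import Data.Nat.Tactic.RingSolver using (solve-∀)
open import Data.Product using (_,_; proj₁; proj₂; ∃-syntax)
open import Data.Sum using (inj₁; inj₂)
open import Induction.WellFounded using (Acc; acc)
open import Relation.Binary.Definitions using (tri<; tri≈; tri>)
open import Relation.Binary.PropositionalEquality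
  using (refl; sym; trans; cong; cong₂; subst; subst₂; module ≡-Reasoning)
open import Relation.Nullary using (contradiction; yes; no)

private variable
  p q c d m i j : ℕ

m%'n≤n : ∀ m n → m %' n ≤ n
m%'n≤n m zero    = z≤n
m%'n≤n m (suc n) = m%n≤n m (suc n)

m%'n<n : ∀ m {n} → 0 < n → m %' n < n
m%'n<n m {suc n} _ = m%n<n m (suc n)

m≡m%'n+[m/'n]*n : ∀ m {n} → 0 < n → m ≡ m %' n + (m /' n) * n
m≡m%'n+[m/'n]*n m {suc n} _ = m≡m%n+[m/n]*n m (suc n)

m≥n⇒m/'n>0 : ∀ {m n} → 0 < n → n ≤ m → 0 < m /' n
m≥n⇒m/'n>0 {n = suc n} _ n≤m = m≥n⇒m/n>0 n≤m

rpair-suc : ∀ p q i → rpair p q (suc i) ≡ rpair q (p %' q) i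
rpair-suc p q zero    = refl
rpair-suc p q (suc i) = cong (λ (x , y) → y , x %' y) (rpair-suc p q i)

r-suc : ∀ p q i → r p q (suc i) ≡ r q (p %' q) i
r-suc p q i = cong proj₁ (rpair-suc p q i)

r-suc-suc : ∀ p q i → r p q (suc (suc i)) ≡ r (p %' q) (q %' (p %' q)) i
r-suc-suc p q i = trans (r-suc p q (suc i)) (r-suc q (p %' q) i)

Z-suc-suc : ∀ p q i → Z p q (suc (suc (suc i))) ≡ Z (p %' q) (q %' (p %' q)) (suc i)
Z-suc-suc p q i = cong₂ _/'_ (r-suc-suc p q i) (r-suc-suc p q (suc i))

r-suc-≤ : ∀ i → q ≤ p → r p q (suc i) ≤ r p q i
r-suc-≤ zero q≤p = q≤p
r-suc-≤ {q} {p} (suc i) q≤p = begin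
  r p q (suc (suc i))     ≡⟨ r-suc p q (suc i) ⟩
  r q (p %' q) (suc i)    ≤⟨ r-suc-≤ i (m%'n≤n p q) ⟩
  r q (p %' q) i          ≡⟨ r-suc p q i ⟨
  r p q (suc i)           ∎
  where open ≤-Reasoning

r-antitone : q ≤ p → i ≤ j → r p q j ≤ r p q i
r-antitone {j = zero} q≤p z≤n = ≤-refl
r-antitone {j = suc j} q≤p i≤j with m≤n⇒m<n∨m≡n i≤j
... | inj₁ (s≤s i≤j) = ≤-trans (r-suc-≤ j q≤p) (r-antitone q≤p i≤j)
... | inj₂ refl      = ≤-refl

r≡1⇒index< : ∀ {t} → q ≤ p → r p q t ≡ 1 → 1 < r p q i → i < t
r≡1⇒index< {q} {p} {i} {t} q≤p rt≡1 1<rᵢ =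
  ≰⇒> λ t≤i → <⇒≱ 1<rᵢ (subst (r p q i ≤_) rt≡1 (r-antitone q≤p t≤i))

coprime-%' : 0 < q → Coprime p q → Coprime q (p %' q)
coprime-%' {suc q} _ coprime (i∣q , i∣p%q) = coprime (∣n∣m%n⇒∣m i∣q i∣p%q , i∣q)

coprime⇒r≡1 : Coprime p q → ∃[ t ] r p q t ≡ 1
coprime⇒r≡1 {p} {q} = go (<-wellFounded q)
  where
  go : ∀ {p q} → Acc _<_ q → Coprime p q → ∃[ t ] r p q t ≡ 1
  go {p} {zero}  _        coprime = 0 , coprime (∣-refl , p ∣0)
  go {p} {suc q} (acc rs) coprime
    with t , rt≡1 ← go (rs (m%n<n p (suc q))) (coprime-%' z<s coprime)
    = suc t , trans (r-suc p (suc q) t) rt≡1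

coprime-1<⇒0< : Coprime p q → 1 < p → 0 < q
coprime-1<⇒0< {p} {zero}  coprime 1<p = contradiction (Coprime.0-coprimeTo-m⇒m≡1 (Coprime.sym coprime)) (>⇒≢ 1<p)
coprime-1<⇒0< {p} {suc q} _ _ = z<s

*-+-cancelˡ-≤ : ∀ m {n o e} → e < m → m * n ≤ m * o + e → n ≤ o
*-+-cancelˡ-≤ m {n} {o} {e} e<m mn≤mo+e = s≤s⁻¹ (*-cancelˡ-< m n (suc o) (begin-strict
  m * n       ≤⟨ mn≤mo+e ⟩
  m * o + e   <⟨ +-monoʳ-< (m * o) e<m ⟩
  m * o + m   ≡⟨ +-comm (m * o) m ⟩
  m + m * o   ≡⟨ *-suc m o ⟨
  m * suc o   ∎))
  where open ≤-Reasoning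

module DivisionStep {p q r Z : ℕ} (p≡ : r + Z * q ≡ p) where

  private
    split-quotient : ∀ c d m → q * (m * Z + c) + d ≡ m * (Z * q) + (q * c + d)
    split-quotient c d m = lemma q Z c d m
      where
      lemma : ∀ q Z c d m → q * (m * Z + c) + d ≡ m * (Z * q) + (q * c + d)
      lemma = solve-∀

    split-remainder : ∀ c d → p * c + d ≡ q * (Z * c) + (r * c + d)
    split-remainder c d = begin
      p * c + d                  ≡⟨ cong (λ x → x * c + d) p≡ ⟨
      (r + Z * q) * c + d        ≡⟨ lemma r Z q c d ⟩
      q * (Z * c) + (r * c + d)  ∎
      where
      open ≡-Reasoning
      lemma : ∀ r Z q c d → (r + Z * q) * c + d ≡ q * (Z * c) + (r * c + d)
      lemma = solve-∀

    m*p≡ : ∀ m → m * p ≡ m * (Z * q) + m * r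
    m*p≡ m = trans (cong (m *_) (sym p≡)) (lemma m r Z q)
      where
      lemma : ∀ m r Z q → m * (r + Z * q) ≡ m * (Z * q) + m * r
      lemma = solve-∀

  lift-quotient : ∀ m → q * c + d ≡ m * r → q * (m * Z + c) + d ≡ m * p
  lift-quotient {c} {d} m eq = begin
    q * (m * Z + c) + d        ≡⟨ split-quotient c d m ⟩
    m * (Z * q) + (q * c + d)  ≡⟨ cong (_+_ (m * (Z * q))) eq ⟩
    m * (Z * q) + m * r        ≡⟨ m*p≡ m ⟨
    m * p                      ∎
    where open ≡-Reasoning

  drop-quotient : ∀ m → q * (m * Z + c) + d ≡ m * p → q * c + d ≡ m * r
  drop-quotient {c} {d} m eq = +-cancelˡ-≡ (m * (Z * q)) _ _
    (trans (sym (split-quotient c d m)) (trans eq (m*p≡ m)))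

  quotient-bound : ∀ m → d < q → q * c + d ≡ m * p → m * Z ≤ c
  quotient-bound {d} {c} m d<q eq = *-+-cancelˡ-≤ q d<q (begin
    q * (m * Z)              ≡⟨ lemma q m Z ⟩
    m * (Z * q)              ≤⟨ m≤m+n (m * (Z * q)) (m * r) ⟩
    m * (Z * q) + m * r      ≡⟨ m*p≡ m ⟨
    m * p                    ≡⟨ eq ⟨
    q * c + d                ∎)
    where
    open ≤-Reasoning
    lemma : ∀ q m Z → q * (m * Z) ≡ m * (Z * q)
    lemma = solve-∀

  lift-remainder : ∀ m → r * c + d ≡ m * q → p * c + d ≡ (Z * c + m) * q
  lift-remainder {c} {d} m eq = begin
    p * c + d                  ≡⟨ split-remainder c d ⟩
    q * (Z * c) + (r * c + d)  ≡⟨ cong (_+_ (q * (Z * c))) eq ⟩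
    q * (Z * c) + m * q        ≡⟨ lemma q Z c m ⟩
    (Z * c + m) * q            ∎
    where
    open ≡-Reasoning
    lemma : ∀ q Z c m → q * (Z * c) + m * q ≡ (Z * c + m) * q
    lemma = solve-∀

  drop-remainder : ∀ m → p * c + d ≡ (Z * c + m) * q → r * c + d ≡ m * q
  drop-remainder {c} {d} m eq = +-cancelˡ-≡ (q * (Z * c)) _ _ (begin
    q * (Z * c) + (r * c + d)  ≡⟨ split-remainder c d ⟨
    p * c + d                  ≡⟨ eq ⟩
    (Z * c + m) * q            ≡⟨ lemma q Z c m ⟩
    q * (Z * c) + m * q        ∎)
    where
    open ≡-Reasoning
    lemma : ∀ q Z c m → (Z * c + m) * q ≡ q * (Z * c) + m * q
    lemma = solve-∀

  remainder-bound : ∀ m → 0 < q → p * c + d ≡ m * q → Z * c ≤ m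
  remainder-bound {c} {d} m 0<q eq = *-+-cancelˡ-≤ q 0<q (begin
    q * (Z * c)                ≤⟨ m≤m+n (q * (Z * c)) (r * c + d) ⟩
    q * (Z * c) + (r * c + d)  ≡⟨ split-remainder c d ⟨
    p * c + d                  ≡⟨ eq ⟩
    m * q                      ≡⟨ *-comm m q ⟩
    q * m                      ≡⟨ +-identityʳ (q * m) ⟨
    q * m + 0                  ∎)
    where open ≤-Reasoning

Minimal : ℕ → ℕ → ℕ → ℕ → Set
Minimal p q c d = ∀ {c′ d′} → 0 < c′ → c′ < c → d′ ≤ d → p ∤ q * c′ + d′

MinimalSolution : ℕ → ℕ → ℕ → Set
MinimalSolution p q d = ∃[ c ] 0 < c × p ∣ q * c + d × Minimal p q c d

record IntermediateRemainder (p q d : ℕ) : Set where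
  constructor intermediate
  field
    k z    : ℕ
    z<Z    : z < Z p q (suc (2 * k))
    d+zr≡r : d + z * r p q (suc (2 * k)) ≡ r p q (2 * k)

intermediate-suc-suc : IntermediateRemainder (p %' q) (q %' (p %' q)) d → IntermediateRemainder p q d
intermediate-suc-suc {p} {q} {d} (intermediate k z z<Z eq) =
  intermediate (suc k) z (subst (z <_) (sym Z≡) z<Z) (subst₂ (λ x y → d + z * x ≡ y) (sym r≡) (sym r′≡) eq)
  where
  2[1+k]≡2+2k : 2 * suc k ≡ suc (suc (2 * k))
  2[1+k]≡2+2k = *-suc 2 k
  Z≡ : Z p q (suc (2 * suc k)) ≡ Z (p %' q) (q %' (p %' q)) (suc (2 * k))
  Z≡ = trans (cong (λ i → Z p q (suc i)) 2[1+k]≡2+2k) (Z-suc-suc p q (2 * k))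
  r≡ : r p q (suc (2 * suc k)) ≡ r (p %' q) (q %' (p %' q)) (suc (2 * k))
  r≡ = trans (cong (λ i → r p q (suc i)) 2[1+k]≡2+2k) (r-suc-suc p q (suc (2 * k)))
  r′≡ : r p q (2 * suc k) ≡ r (p %' q) (q %' (p %' q)) (2 * k)
  r′≡ = trans (cong (r p q) 2[1+k]≡2+2k) (r-suc-suc p q (2 * k))

multiple-between⇒≡ : 0 < m * p → m * p < p + p → m * p ≡ p
multiple-between⇒≡ {zero}           0<0 _ = contradiction 0<0 (<-irrefl refl)
multiple-between⇒≡ {suc zero}    {p} _ _ = +-identityʳ p
multiple-between⇒≡ {suc (suc m)} {p} _ kp<2p =
  contradiction kp<2p (≤⇒≯ (+-monoʳ-≤ p (m≤m+n p (m * p))))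

m/'n*n≤m : ∀ m n → (m /' n) * n ≤ m
m/'n*n≤m m zero    = z≤n
m/'n*n≤m m (suc n) = m/n*n≤m m (suc n)

division-step : ∀ p {q} → 0 < q → p %' q + (p /' q) * q ≡ p
division-step p 0<q = sym (m≡m%'n+[m/'n]*n p 0<q)

≤quotient⇒d+c*q≡p : c ≤ p /' q → 0 < d → d < p → p ∣ q * c + d → d + c * q ≡ p
≤quotient⇒d+c*q≡p {c} {p} {q} {d} c≤Z₁ 0<d d<p (divides m eq) = begin
  d + c * q   ≡⟨ +-comm d (c * q) ⟩
  c * q + d   ≡⟨ cong (_+ d) (*-comm c q) ⟩
  q * c + d   ≡⟨ eq ⟩
  m * p       ≡⟨ multiple-between⇒≡ {m} {p} (subst (0 <_) eq (<-≤-trans 0<d (m≤n+m d (q * c))))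
                                    (subst (_< p + p) eq (+-mono-≤-< qc≤p d<p)) ⟩
  p           ∎
  where
  open ≡-Reasoning
  qc≤p : q * c ≤ p
  qc≤p = ≤-trans (≤-reflexive (*-comm q c)) (≤-trans (*-monoˡ-≤ q c≤Z₁) (m/'n*n≤m p q))

minimal⇒<remainder : 0 < q → q < p → p /' q < c → Minimal p q c d → d < p %' q
minimal⇒<remainder {q} {p} {c} {d} 0<q q<p Z₁<c minimal with p %' q ≤? d
... | yes r₂≤d = ⊥-elim (minimal 0<Z₁ Z₁<c r₂≤d (divides 1 single-step))
  where
  0<Z₁ : 0 < p /' q
  0<Z₁ = m≥n⇒m/'n>0 0<q (<⇒≤ q<p)
  single-step : q * (p /' q) + p %' q ≡ 1 * p
  single-step = begin
    q * (p /' q) + p %' q  ≡⟨ cong (_+ p %' q) (*-comm q (p /' q)) ⟩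
    (p /' q) * q + p %' q  ≡⟨ +-comm ((p /' q) * q) (p %' q) ⟩
    p %' q + (p /' q) * q  ≡⟨ division-step p 0<q ⟩
    p                      ≡⟨ *-identityˡ p ⟨
    1 * p                  ∎
    where open ≡-Reasoning
... | no r₂≰d = ≰⇒> r₂≰d

descend : 0 < q → 0 < d → d < p %' q → p ∣ q * c + d → Minimal p q c d →
  MinimalSolution (p %' q) (q %' (p %' q)) d
descend {q} {d} {p} {c} 0<q 0<d d<r₂ (divides m eq) minimal = c₂ , 0<c₂ , divides m₂ eq₂ , minimal₂
  where
  r₂ = p %' q
  r₃ = q %' r₂
  Z₁ = p /' q
  Z₂ = q /' r₂
  0<r₂ : 0 < r₂
  0<r₂ = <-≤-trans 0<d (<⇒≤ d<r₂)
  instance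
    r₂≢0 : NonZero r₂
    r₂≢0 = >-nonZero 0<r₂
  module Step₁ = DivisionStep {r = r₂} {Z = Z₁} (division-step p 0<q)
  module Step₂ = DivisionStep {r = r₃} {Z = Z₂} (division-step q 0<r₂)
  mZ₁≤c : m * Z₁ ≤ c
  mZ₁≤c = Step₁.quotient-bound m (<-trans d<r₂ (m%'n<n p 0<q)) eq
  c₂ = c ∸ m * Z₁
  c≡ : m * Z₁ + c₂ ≡ c
  c≡ = m+[n∸m]≡n mZ₁≤c
  eq₁ : q * c₂ + d ≡ m * r₂
  eq₁ = Step₁.drop-quotient m (subst (λ x → q * x + d ≡ m * p) (sym c≡) eq)
  Z₂c₂≤m : Z₂ * c₂ ≤ m
  Z₂c₂≤m = Step₂.remainder-bound m 0<r₂ eq₁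
  m₂ = m ∸ Z₂ * c₂
  m≡ : Z₂ * c₂ + m₂ ≡ m
  m≡ = m+[n∸m]≡n Z₂c₂≤m
  eq₂ : r₃ * c₂ + d ≡ m₂ * r₂
  eq₂ = Step₂.drop-remainder m₂ (subst (λ x → q * c₂ + d ≡ x * r₂) (sym m≡) eq₁)
  0<c₂ : 0 < c₂
  0<c₂ = n≢0⇒n>0 λ c₂≡0 → >⇒∤ ⦃ >-nonZero 0<d ⦄ d<r₂ (divides m (begin
    d           ≡⟨ cong (_+ d) (*-zeroʳ q) ⟨
    q * 0 + d   ≡⟨ cong (λ x → q * x + d) c₂≡0 ⟨
    q * c₂ + d  ≡⟨ eq₁ ⟩
    m * r₂      ∎))
    where open ≡-Reasoning
  -- Undoing the two reductions is monotone in the multiplier, so a smaller relation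
  -- for (r₂, r₃) would lift to a smaller one for (p, q).
  minimal₂ : Minimal r₂ r₃ c₂ d
  minimal₂ {c′} {d′} 0<c′ c′<c₂ d′≤d (divides k′ eq′) = minimal 0<c″ c″<c d′≤d (divides m′ (Step₁.lift-quotient m′ eq″))
    where
    m′ = Z₂ * c′ + k′
    eq″ : q * c′ + d′ ≡ m′ * r₂
    eq″ = Step₂.lift-remainder k′ eq′
    m′≤m : m′ ≤ m
    m′≤m = *-cancelʳ-≤ m′ m r₂ (begin
      m′ * r₂     ≡⟨ eq″ ⟨
      q * c′ + d′ ≤⟨ +-mono-≤ (*-monoʳ-≤ q (<⇒≤ c′<c₂)) d′≤d ⟩
      q * c₂ + d  ≡⟨ eq₁ ⟩
      m * r₂      ∎)
      where open ≤-Reasoning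
    0<c″ : 0 < m′ * Z₁ + c′
    0<c″ = <-≤-trans 0<c′ (m≤n+m c′ (m′ * Z₁))
    c″<c : m′ * Z₁ + c′ < c
    c″<c = subst (m′ * Z₁ + c′ <_) c≡ (+-mono-≤-< (*-monoˡ-≤ Z₁ m′≤m) c′<c₂)

minimal⇒intermediate : Acc _<_ p → Coprime p q → 0 < q → q < p → 1 < d → d < p →
  MinimalSolution p q d → IntermediateRemainder p q d
minimal⇒intermediate {p} {q} {d} (acc rs) coprime 0<q q<p 1<d d<p (c , 0<c , p∣qc+d , minimal)
  with <-cmp c (p /' q)
... | tri< c<Z₁ _ _ = intermediate 0 c c<Z₁ (≤quotient⇒d+c*q≡p (<⇒≤ c<Z₁) (<-trans z<s 1<d) d<p p∣qc+d)
... | tri≈ _ refl _ = intermediate 1 0 0<Z₃ (trans (+-identityʳ d) d≡r₂)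
  where
  d≡r₂ : d ≡ p %' q
  d≡r₂ = +-cancelʳ-≡ ((p /' q) * q) d (p %' q)
    (trans (≤quotient⇒d+c*q≡p {q = q} ≤-refl (<-trans z<s 1<d) d<p p∣qc+d) (sym (division-step p 0<q)))
  1<r₂ : 1 < p %' q
  1<r₂ = subst (1 <_) d≡r₂ 1<d
  0<r₂ : 0 < p %' q
  0<r₂ = <-trans z<s 1<r₂
  0<r₃ : 0 < q %' (p %' q)
  0<r₃ = coprime-1<⇒0< (coprime-%' 0<r₂ (coprime-%' 0<q coprime)) 1<r₂
  0<Z₃ : 0 < Z p q 3
  0<Z₃ = m≥n⇒m/'n>0 0<r₃ (<⇒≤ (m%'n<n q 0<r₂))
... | tri> _ _ Z₁<c = intermediate-suc-suc (minimal⇒intermediate (rs r₂<p) coprime₂ 0<r₃ (m%'n<n q 0<r₂) 1<d d<r₂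
                        (descend 0<q (<-trans z<s 1<d) d<r₂ p∣qc+d minimal))
  where
  d<r₂ : d < p %' q
  d<r₂ = minimal⇒<remainder 0<q q<p Z₁<c minimal
  0<r₂ : 0 < p %' q
  0<r₂ = <-trans (<-trans z<s 1<d) d<r₂
  r₂<p : p %' q < p
  r₂<p = <-trans (m%'n<n p 0<q) q<p
  coprime₂ : Coprime (p %' q) (q %' (p %' q))
  coprime₂ = coprime-%' 0<r₂ (coprime-%' 0<q coprime)
  0<r₃ : 0 < q %' (p %' q)
  0<r₃ = coprime-1<⇒0< coprime₂ (<-trans 1<d d<r₂)

∣-<⇒≡0 : ∀ {m n} → n < m → m ∣ n → n ≡ 0
∣-<⇒≡0 {n = zero}  _   _   = refl
∣-<⇒≡0 {n = suc n} n<m m∣n = contradiction (∣⇒≤ m∣n) (<⇒≱ n<m)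

residues-≡ : ∀ {p m n} → m < p → n < p → + p ∣ˢ + m -ℤ + n → m ≡ n
residues-≡ {p} {m} {n} m<p n<p p∣m-n = ℤ.+-injective (ℤ.i-j≡0⇒i≡j (+ m) (+ n) (ℤ.∣i∣≡0⇒i≡0 ∣m-n∣≡0))
  where
  ∣m-n∣<p : ∣ + m -ℤ + n ∣ < p
  ∣m-n∣<p = ≤-<-trans (subst (_≤ m ⊔ n) (cong ∣_∣ (sym (ℤ.m-n≡m⊖n m n))) (ℤ.∣m⊝n∣≤m⊔n m n)) (⊔-lub m<p n<p)
  ∣m-n∣≡0 : ∣ + m -ℤ + n ∣ ≡ 0
  ∣m-n∣≡0 = ∣-<⇒≡0 ∣m-n∣<p (∣⇒∣ᵤ p∣m-n)

%ℕ-congruent : ∀ x p .{{_ : NonZero p}} → + p ∣ˢ x -ℤ + (x %ℕ p)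
%ℕ-congruent x p = Signed.divides (x /ℕ p) (begin
  x -ℤ + (x %ℕ p)                                   ≡⟨ cong (_-ℤ + (x %ℕ p)) (a≡a%ℕn+[a/ℕn]*n x p) ⟩
  (+ (x %ℕ p) +ℤ (x /ℕ p) *ℤ + p) -ℤ + (x %ℕ p)     ≡⟨ lemma (+ (x %ℕ p)) ((x /ℕ p) *ℤ + p) ⟩
  (x /ℕ p) *ℤ + p                                   ∎)
  where
  open ≡-Reasoning
  lemma : ∀ r s → (r +ℤ s) -ℤ r ≡ s
  lemma = ℤ-Ring.solve-∀

%ℕ-unique : ∀ x {y p} .{{_ : NonZero p}} → y < p → + p ∣ˢ x -ℤ + y → x %ℕ p ≡ y
%ℕ-unique x {y} {p} y<p p∣x-y = residues-≡ (n%ℕd<d x p) y<p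
  (subst (+ p ∣ˢ_) (lemma x (+ y) (+ (x %ℕ p))) (∣m∣n⇒∣m-n p∣x-y (%ℕ-congruent x p)))
  where
  lemma : ∀ x y r → (x -ℤ y) -ℤ (x -ℤ r) ≡ r -ℤ y
  lemma = ℤ-Ring.solve-∀

inverse⇒coprime : ∀ {p r} (u : ℤ) → + p ∣ˢ u *ℤ + r -ℤ + 1 → Coprime p r
inverse⇒coprime {p} {r} u p∣ur-1 (i∣p , i∣r) = ∣1⇒≡1 (∣⇒∣ᵤ (subst (+ _ ∣ˢ_) (lemma (u *ℤ + r))
  (∣m∣n⇒∣m-n (∣n⇒∣m*n u (∣ᵤ⇒∣ i∣r)) (Signed.∣-trans (∣ᵤ⇒∣ i∣p) p∣ur-1))))
  where
  lemma : ∀ x → x -ℤ (x -ℤ + 1) ≡ + 1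
  lemma = ℤ-Ring.solve-∀

module _ {k : ℤ} (u r a A : ℤ) (k∣ur-1 : k ∣ˢ u *ℤ r -ℤ + 1) (k∣ua-A : k ∣ˢ u *ℤ a -ℤ A) where

  residue-difference : ∀ b B → k ∣ˢ u *ℤ b -ℤ B → k ∣ˢ r *ℤ (A -ℤ B) +ℤ (b -ℤ a)
  residue-difference b B k∣ub-B = subst (k ∣ˢ_) (sym (lemma u r a b A B))
    (∣m∣n⇒∣m-n (∣m⇒∣m*n (a -ℤ b) k∣ur-1) (∣n⇒∣m*n r (∣m∣n⇒∣m-n k∣ua-A k∣ub-B)))
    where
    lemma : ∀ u r a b A B → r *ℤ (A -ℤ B) +ℤ (b -ℤ a)
                          ≡ (u *ℤ r -ℤ + 1) *ℤ (a -ℤ b) -ℤ r *ℤ ((u *ℤ a -ℤ A) -ℤ (u *ℤ b -ℤ B))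
    lemma = ℤ-Ring.solve-∀

  residue-shift : ∀ c e → k ∣ˢ r *ℤ c +ℤ e → k ∣ˢ u *ℤ (a +ℤ e) -ℤ (A -ℤ c)
  residue-shift c e k∣rc+e = subst (k ∣ˢ_) (sym (lemma u r a A c e))
    (∣m∣n⇒∣m-n (∣m∣n⇒∣m+n k∣ua-A (∣n⇒∣m*n u k∣rc+e)) (∣m⇒∣m*n c k∣ur-1))
    where
    lemma : ∀ u r a A c e → u *ℤ (a +ℤ e) -ℤ (A -ℤ c)
                          ≡ (u *ℤ a -ℤ A) +ℤ u *ℤ (r *ℤ c +ℤ e) -ℤ (u *ℤ r -ℤ + 1) *ℤ c
    lemma = ℤ-Ring.solve-∀

pos-linear : ∀ r c e → + (r * c + e) ≡ + r *ℤ + c +ℤ + e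
pos-linear r c e = trans (ℤ.pos-+ (r * c) e) (cong (_+ℤ + e) (ℤ.pos-* r c))

pos-∸ : ∀ {m n} → n ≤ m → + (m ∸ n) ≡ + m -ℤ + n
pos-∸ {m} {n} n≤m = sym (trans (ℤ.m-n≡m⊖n m n) (ℤ.⊖-≥ n≤m))

∣⇒∣ˢ-linear : ∀ {p} r c e → p ∣ r * c + e → + p ∣ˢ + r *ℤ + c +ℤ + e
∣⇒∣ˢ-linear r c e p∣ = ∣ᵤ⇒∣ (subst (_ ∣_) (cong ∣_∣ (pos-linear r c e)) p∣)

∣ˢ⇒∣-linear : ∀ {p} r c e → + p ∣ˢ + r *ℤ + c +ℤ + e → p ∣ r * c + e
∣ˢ⇒∣-linear r c e p∣ = subst (_ ∣_) (cong ∣_∣ (sym (pos-linear r c e))) (∣⇒∣ᵤ p∣)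

m+n≡o⇒+m≡+o-+n : ∀ {m n o} → m + n ≡ o → + m ≡ + o -ℤ + n
m+n≡o⇒+m≡+o-+n {m} {n} refl = trans (lemma (+ m) (+ n)) (cong (_-ℤ + n) (sym (ℤ.pos-+ m n)))
  where
  lemma : ∀ x y → x ≡ x +ℤ y -ℤ y
  lemma = ℤ-Ring.solve-∀

module IntervalCondition {p} .{{_ : NonZero p}} (u : ℤ) (r₁ : ℕ) (inverse : + p ∣ˢ u *ℤ + r₁ -ℤ + 1)
  (a b : ℤ) {d : ℕ} (b-a≡d : b -ℤ a ≡ + d)
  (between : ∀ n → a <ℤ n → n <ℤ b → ((u *ℤ a) %ℕ p) ⊔ ((u *ℤ b) %ℕ p) < (u *ℤ n) %ℕ p)
  (B<A : (u *ℤ b) %ℕ p < (u *ℤ a) %ℕ p)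
  where

  A = (u *ℤ a) %ℕ p
  B = (u *ℤ b) %ℕ p

  a+d≡b : a +ℤ + d ≡ b
  a+d≡b = trans (cong (a +ℤ_) (sym b-a≡d)) (lemma a b)
    where
    lemma : ∀ a b → a +ℤ (b -ℤ a) ≡ b
    lemma = ℤ-Ring.solve-∀

  residue-after : ∀ {c′ d′} → c′ ≤ A → p ∣ r₁ * c′ + d′ → (u *ℤ (a +ℤ + d′)) %ℕ p ≡ A ∸ c′
  residue-after {c′} {d′} c′≤A p∣ = %ℕ-unique (u *ℤ (a +ℤ + d′)) (≤-<-trans (m∸n≤m A c′) (n%ℕd<d (u *ℤ a) p))
    (subst (λ x → + p ∣ˢ u *ℤ (a +ℤ + d′) -ℤ x) (sym (pos-∸ c′≤A))
      (residue-shift u (+ r₁) a (+ A) inverse (%ℕ-congruent (u *ℤ a) p) (+ c′) (+ d′) (∣⇒∣ˢ-linear r₁ c′ d′ p∣)))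

  solution : p ∣ r₁ * (A ∸ B) + d
  solution = ∣ˢ⇒∣-linear r₁ (A ∸ B) d (subst₂ (λ x y → + p ∣ˢ + r₁ *ℤ x +ℤ y) (sym (pos-∸ (<⇒≤ B<A))) b-a≡d
    (residue-difference u (+ r₁) a (+ A) inverse (%ℕ-congruent (u *ℤ a) p) b (+ B) (%ℕ-congruent (u *ℤ b) p)))

  minimal : Minimal p r₁ (A ∸ B) d
  minimal {c′} {d′} 0<c′ c′<c d′≤d p∣ = excluded (≤-trans (<⇒≤ c′<c) (m∸n≤m A B))
    where
    excluded : c′ ≤ A → ⊥
    excluded c′≤A with d′ ≟ 0 | d′ ≟ d
    ... | yes refl | _ = <-irrefl (sym (trans (cong (λ x → (u *ℤ x) %ℕ p) (sym (ℤ.+-identityʳ a))) (residue-after c′≤A p∣)))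
                                  (∸-monoʳ-< 0<c′ c′≤A)
    ... | no _ | yes refl = <-irrefl (trans (sym (m∸[m∸n]≡n c′≤A)) (cong (A ∸_) (sym B≡A-c′))) c′<c
      where
      B≡A-c′ : B ≡ A ∸ c′
      B≡A-c′ = trans (cong (λ x → (u *ℤ x) %ℕ p) (sym a+d≡b)) (residue-after c′≤A p∣)
    ... | no d′≢0 | no d′≢d = <⇒≱ (between (a +ℤ + d′) a<a+d′ a+d′<b) (begin
      (u *ℤ (a +ℤ + d′)) %ℕ p  ≡⟨ residue-after c′≤A p∣ ⟩
      A ∸ c′                  ≤⟨ m∸n≤m A c′ ⟩
      A                       ≤⟨ m≤m⊔n A B ⟩
      A ⊔ B                   ∎)
      where
      open ≤-Reasoning
      a<a+d′ : a <ℤ a +ℤ + d′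
      a<a+d′ = subst (_<ℤ a +ℤ + d′) (ℤ.+-identityʳ a) (ℤ.+-monoʳ-< a (+<+ (n≢0⇒n>0 d′≢0)))
      a+d′<b : a +ℤ + d′ <ℤ b
      a+d′<b = subst (a +ℤ + d′ <ℤ_) a+d≡b (ℤ.+-monoʳ-< a (+<+ (≤∧≢⇒< d′≤d d′≢d)))

  minimalSolution : MinimalSolution p r₁ d
  minimalSolution = A ∸ B , m<n⇒0<n∸m B<A , solution , minimal

lemma10 : (p : ℕ) → 3 ≤ p → (u : ℤ) → Coprime ∣ u ∣ p →
    (r₁ : ℕ) → 0 < r₁ → r₁ < p → (+ p) ∣ℤ ((u *ℤ (+ r₁)) -ℤ (+ 1)) →
    (a b : ℤ) → a <ℤ b → (+ 1) <ℤ (b -ℤ a) → (b -ℤ a) <ℤ (+ p) →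
    ((n : ℤ) → a <ℤ n → n <ℤ b →
      ((⟨ u *ℤ a ⟩ p) ⊔ (⟨ u *ℤ b ⟩ p)) < ⟨ u *ℤ n ⟩ p) →
    ⟨ u *ℤ b ⟩ p < ⟨ u *ℤ a ⟩ p →
    Σ ℕ λ t → Σ ℕ λ k → Σ ℕ λ z →
      (r p r₁ t ≡ 1) × (2 * k + 1 ≤ t) × (z < Z p r₁ (2 * k + 1)) ×
      (b -ℤ a ≡ (+ r p r₁ (2 * k)) -ℤ (+ (z * r p r₁ (2 * k + 1))))
lemma10 zero ()
lemma10 p@(suc _) _ u _ r₁ 0<r₁ r₁<p p∣ur₁-1 a b _ 1<b-a b-a<p between B<A =
  t , k , z , rₜ≡1 , subst (_≤ t) (sym odd) 2k<t , subst (λ i → z < Z p r₁ i) (sym odd) z<Z , gap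
  where
  inverse : + p ∣ˢ u *ℤ + r₁ -ℤ + 1
  inverse = ∣ᵤ⇒∣ p∣ur₁-1
  ∣b-a∣ = ∣ b -ℤ a ∣
  b-a≡∣b-a∣ : b -ℤ a ≡ + ∣b-a∣
  b-a≡∣b-a∣ = sym (ℤ.0≤i⇒+∣i∣≡i (ℤ.<⇒≤ (ℤ.<-trans (+<+ z<s) 1<b-a)))
  1<∣b-a∣ : 1 < ∣b-a∣
  1<∣b-a∣ = ℤ.drop‿+<+ (subst (+ 1 <ℤ_) b-a≡∣b-a∣ 1<b-a)
  ∣b-a∣<p : ∣b-a∣ < p
  ∣b-a∣<p = ℤ.drop‿+<+ (subst (_<ℤ + p) b-a≡∣b-a∣ b-a<p)
  coprime : Coprime p r₁
  coprime = inverse⇒coprime u inverse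
  t = proj₁ (coprime⇒r≡1 coprime)
  rₜ≡1 : r p r₁ t ≡ 1
  rₜ≡1 = proj₂ (coprime⇒r≡1 coprime)
  open IntermediateRemainder (minimal⇒intermediate (<-wellFounded p) coprime 0<r₁ r₁<p 1<∣b-a∣ ∣b-a∣<p
    (IntervalCondition.minimalSolution u r₁ inverse a b b-a≡∣b-a∣ between B<A))
  odd : 2 * k + 1 ≡ suc (2 * k)
  odd = +-comm (2 * k) 1
  2k<t : 2 * k < t
  2k<t = r≡1⇒index< (<⇒≤ r₁<p) rₜ≡1 (<-≤-trans 1<∣b-a∣ (subst (∣b-a∣ ≤_) d+zr≡r (m≤m+n ∣b-a∣ _)))
  gap : b -ℤ a ≡ + r p r₁ (2 * k) -ℤ + (z * r p r₁ (2 * k + 1))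
  gap = trans b-a≡∣b-a∣ (m+n≡o⇒+m≡+o-+n (subst (λ i → ∣b-a∣ + z * r p r₁ i ≡ r p r₁ (2 * k)) (sym odd) d+zr≡r))
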